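{- Let $(T,\lambda)$ be an edge-labeled phylogenetic tree. If $e$ is an inner 0-edge of $(T,\lambda)$, then $\mathcal{X}_{(T_e,\lambda_e)}=\mathcal{X}_{(T,\lambda)}$. If $e$ is an inner 1-edge, then $\mathcal{X}_{(T_e,\lambda_e)}\subseteq\mathcal{X}_{(T,\lambda)}$.
   Context: Phylogenetic tree: rooted tree whose root has degree $\ge2$ and other inner vertices degree $\ge3$. Edge-labeled: $\lambda:E\to\{0,1\}$; 1-edges and 0-edges. Inner edge: both endpoints inner vertices. $\mathcal{X}_{(T,\lambda)}$: for distinct leaves $x,y$, $(x,y)\in\mathcal{X}_{(T,\lambda)}$ iff the path from $\operatorname{lca}(x,y)$ to $y$ contains a 1-edge. For an inner edge $e$, $(T_e,\lambda_e)$ is obtained by contracting $e$ (removing it and identifying its endpoints) and keeping the labels of all other edges. -}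

module Defs where

open import Data.Nat using (ℕ; _≤_)
open import Data.Bool using (Bool; true; false)
open import Data.Product using (_×_; _,_; proj₁; proj₂)
open import Data.Sum using (_⊎_)
open import Data.Fin using (Fin)
open import Data.List using (List; []; _∷_; _++_; length; lookup)
open import Data.List.Membership.Propositional using (_∈_)
open import Data.List.Relation.Unary.All using (All)
open import Data.List.Relation.Unary.Unique.Propositional using (Unique)
open import Relation.Binary.PropositionalEquality using (_≡_; _≢_)

-- A vertex is either a leaf (carrying its name,
-- a natural number) or an inner vertex with an ordered list of children;
-- each child comes with the label of the edge from the parent to it
-- (true = 1-edge, false = 0-edge).
data Tree : Set where
  leaf : ℕ → Tree
  node : List (Bool × Tree) → Tree

label : (cs : List (Bool × Tree)) → Fin (length cs) → Bool
label cs i = proj₁ (lookup cs i)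

child : (cs : List (Bool × Tree)) → Fin (length cs) → Tree
child cs i = proj₂ (lookup cs i)

mutual
  leaves : Tree → List ℕ
  leaves (leaf x) = x ∷ []
  leaves (node cs) = leavesL cs

  leavesL : List (Bool × Tree) → List ℕ
  leavesL [] = []
  leavesL ((_ , c) ∷ cs) = leaves c ++ leavesL cs

-- every inner vertex has at least 2 children (root degree ≥ 2, other
-- inner vertices degree ≥ 3)
data Branching : Tree → Set where
  leaf : ∀ {x} → Branching (leaf x)
  node : ∀ {cs} → 2 ≤ length cs → All (λ p → Branching (proj₂ p)) cs →
         Branching (node cs)

Phylogenetic : Tree → Set
Phylogenetic t = Branching t × Unique (leaves t)

data Has1 : Tree → ℕ → Set where
  step : ∀ {cs y} (i : Fin (length cs)) → y ∈ leaves (child cs i) →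
         (label cs i ≡ true ⊎ Has1 (child cs i) y) → Has1 (node cs) y

-- XR t x y : with lca(x,y) the vertex where the root-paths of x and y
-- diverge, the path from lca(x,y) to y contains a 1-edge.
data XR : Tree → ℕ → ℕ → Set where
  -- lca(x,y) is the root: x and y lie below different children i ≠ j
  top  : ∀ {cs x y} (i j : Fin (length cs)) → i ≢ j →
         x ∈ leaves (child cs i) → y ∈ leaves (child cs j) →
         (label cs j ≡ true ⊎ Has1 (child cs j) y) → XR (node cs) x y
  -- lca(x,y) lies inside the i-th child subtree
  down : ∀ {cs x y} (i : Fin (length cs)) → XR (child cs i) x y →
         XR (node cs) x y

𝒳 : Tree → ℕ → ℕ → Set
𝒳 t x y = x ≢ y × XR t x y

-- Contract t b t' : t' = T_e is obtained from t by contracting an inner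
-- edge e (both endpoints inner vertices) with label λ(e) = b; all other
-- edge labels are kept.
data Contract : Tree → Bool → Tree → Set where
  here  : ∀ l r b ds →
          Contract (node (l ++ (b , node ds) ∷ r)) b (node (l ++ ds ++ r))
  there : ∀ {c c' b} l r b₀ → Contract c b c' →
          Contract (node (l ++ (b₀ , c) ∷ r)) b (node (l ++ (b₀ , c') ∷ r))

module Submission where

-- Contracting an inner edge e = (u,v) moves the children of v up to u.
-- Whether (x,y) ∈ 𝒳 at an inner vertex depends on its child list only
-- through three per-child predicates: "x is below this child", "y is
-- below this child and the edge path to y carries a 1-edge", and
-- "(x,y) ∈ 𝒳 inside this child".  Hence we compare trees by the
-- preorder c ⊑ c' ("every leaf, every 1-edge path to a leaf and every
-- pair of 𝒳 seen in c is also seen in c'") and show: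
--   * a generic list lemma: transfer of such witnesses from a sublist m
--     to m' extends to l ++ m ++ r versus l ++ m' ++ r (module Divergence);
--   * hence ⊑ is a congruence for child lists (⊑-context, ⊑-child);
--   * at the contracted edge, ds ⊑ (b , node ds), and, for a 0-edge,
--     (false , node ds) ⊑ ds (⊑-expand, ⊑-contract0).
-- By induction on the contraction, T_e ⊑ T always and T ⊑ T_e for a
-- 0-edge; lemma5 follows.

open import Defs
open import Data.Nat using (ℕ)
open import Data.Bool using (Bool; true; false)
open import Data.Product using (_×_; _,_; proj₁; proj₂)
open import Data.Sum using (_⊎_; inj₁; inj₂)
import Data.Sum as Sum
open import Data.Fin using (Fin; zero; suc)
open import Data.Fin.Properties using (suc-injective)
open import Data.List using (List; []; _∷_; _++_; length; lookup)
open import Data.List.Relation.Unary.Any using (Any; here; there; index)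
import Data.List.Relation.Unary.Any as Any
open import Data.List.Relation.Unary.Any.Properties using (++⁺ˡ; ++⁺ʳ; ++⁻; lookup-index)
open import Data.List.Membership.Propositional using (_∈_; lose)
open import Data.List.Membership.Propositional.Properties using (∈-lookup)
open import Relation.Binary.PropositionalEquality using (_≡_; _≢_; refl; cong; subst)
open import Data.Empty using (⊥-elim)

any-context : ∀ {A : Set} {S : A → Set} l r {m m' : List A} →
              (Any S m → Any S m') → Any S (l ++ m ++ r) → Any S (l ++ m' ++ r)
any-context l r {m} {m'} f a with ++⁻ l a
... | inj₁ al = ++⁺ˡ al
... | inj₂ amr with ++⁻ m amr
...   | inj₁ am = ++⁺ʳ l (++⁺ˡ (f am))
...   | inj₂ ar = ++⁺ʳ l (++⁺ʳ m' ar)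

∈-++[] : ∀ {A : Set} {x : A} xs → x ∈ xs ++ [] → x ∈ xs
∈-++[] xs x∈ with ++⁻ xs x∈
... | inj₁ x∈xs = x∈xs

-- Witnesses in a list for a relation that, like 𝒳 at an inner vertex,
-- holds if P and Q hold at two different positions, or R holds somewhere.
module Divergence {A : Set} (P Q R : A → Set) where

  data Two : List A → Set where
    P-here : ∀ {a as} → P a → Any Q as → Two (a ∷ as)
    Q-here : ∀ {a as} → Q a → Any P as → Two (a ∷ as)
    later  : ∀ {a as} → Two as → Two (a ∷ as)

  Rel : List A → Set
  Rel cs = Two cs ⊎ Any R cs

  record TwoAt (cs : List A) : Set where
    field
      i j      : Fin (length cs)
      distinct : i ≢ j
      P-at     : P (lookup cs i)
      Q-at     : Q (lookup cs j)

  two-at : ∀ cs (i j : Fin (length cs)) → i ≢ j →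
           P (lookup cs i) → Q (lookup cs j) → Two cs
  two-at (_ ∷ _)  zero    zero    i≢j p q = ⊥-elim (i≢j refl)
  two-at (_ ∷ _)  zero    (suc j) i≢j p q = P-here p (lose (∈-lookup j) q)
  two-at (_ ∷ _)  (suc i) zero    i≢j p q = Q-here q (lose (∈-lookup i) p)
  two-at (_ ∷ cs) (suc i) (suc j) i≢j p q =
    later (two-at cs i j (λ i≡j → i≢j (cong suc i≡j)) p q)

  two-index : ∀ {cs} → Two cs → TwoAt cs
  two-index (P-here p q) = record
    { i = zero ; j = suc (index q) ; distinct = λ () ; P-at = p ; Q-at = lookup-index q }
  two-index (Q-here q p) = record
    { i = suc (index p) ; j = zero ; distinct = λ () ; P-at = lookup-index p ; Q-at = q }
  two-index (later t) = record
    { i = suc i ; j = suc j ; distinct = λ si≡sj → distinct (suc-injective si≡sj)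
    ; P-at = P-at ; Q-at = Q-at }
    where open TwoAt (two-index t)

  Straddle : List A → List A → Set
  Straddle u v = (Any P u × Any Q v) ⊎ (Any Q u × Any P v)

  two-++⁻ : ∀ u {v} → Two (u ++ v) → Two u ⊎ Two v ⊎ Straddle u v
  two-++⁻ []      t = inj₂ (inj₁ t)
  two-++⁻ (_ ∷ u) (P-here p q) with ++⁻ u q
  ... | inj₁ qu = inj₁ (P-here p qu)
  ... | inj₂ qv = inj₂ (inj₂ (inj₁ (here p , qv)))
  two-++⁻ (_ ∷ u) (Q-here q p) with ++⁻ u p
  ... | inj₁ pu = inj₁ (Q-here q pu)
  ... | inj₂ pv = inj₂ (inj₂ (inj₂ (here q , pv)))
  two-++⁻ (_ ∷ u) (later t) with two-++⁻ u t
  ... | inj₁ tu                    = inj₁ (later tu)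
  ... | inj₂ (inj₁ tv)             = inj₂ (inj₁ tv)
  ... | inj₂ (inj₂ (inj₁ (p , q))) = inj₂ (inj₂ (inj₁ (there p , q)))
  ... | inj₂ (inj₂ (inj₂ (q , p))) = inj₂ (inj₂ (inj₂ (there q , p)))

  two-++⁺ : ∀ u {v} → Two u ⊎ Two v ⊎ Straddle u v → Two (u ++ v)
  two-++⁺ u {v} (inj₁ tu)                    = left tu
    where
    left : ∀ {u} → Two u → Two (u ++ v)
    left (P-here p q) = P-here p (++⁺ˡ q)
    left (Q-here q p) = Q-here q (++⁺ˡ p)
    left (later t)    = later (left t)
  two-++⁺ u (inj₂ (inj₁ tv))                 = right u
    where
    right : ∀ u → Two (u ++ _)
    right []      = tv
    right (_ ∷ u) = later (right u)
  two-++⁺ u {v} (inj₂ (inj₂ (inj₁ (p , q)))) = PQ p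
    where
    PQ : ∀ {u} → Any P u → Two (u ++ v)
    PQ {_ ∷ u} (here p)  = P-here p (++⁺ʳ u q)
    PQ         (there p) = later (PQ p)
  two-++⁺ u {v} (inj₂ (inj₂ (inj₂ (q , p)))) = QP q
    where
    QP : ∀ {u} → Any Q u → Two (u ++ v)
    QP {_ ∷ u} (here q)  = Q-here q (++⁺ʳ u p)
    QP         (there q) = later (QP q)

  rel-++⁻ : ∀ u {v} → Rel (u ++ v) → Rel u ⊎ Rel v ⊎ Straddle u v
  rel-++⁻ u (inj₁ t) = Sum.map inj₁ (Sum.map₁ inj₁) (two-++⁻ u t)
  rel-++⁻ u (inj₂ a) = Sum.map inj₂ (λ av → inj₁ (inj₂ av)) (++⁻ u a)

  rel-++⁺ : ∀ u {v} → Rel u ⊎ Rel v ⊎ Straddle u v → Rel (u ++ v)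
  rel-++⁺ u (inj₁ (inj₁ tu))        = inj₁ (two-++⁺ u (inj₁ tu))
  rel-++⁺ u (inj₁ (inj₂ au))        = inj₂ (++⁺ˡ au)
  rel-++⁺ u (inj₂ (inj₁ (inj₁ tv))) = inj₁ (two-++⁺ u (inj₂ (inj₁ tv)))
  rel-++⁺ u (inj₂ (inj₁ (inj₂ av))) = inj₂ (++⁺ʳ u av)
  rel-++⁺ u (inj₂ (inj₂ s))         = inj₁ (two-++⁺ u (inj₂ (inj₂ s)))

  module _ {m m' : List A} (fP : Any P m → Any P m') (fQ : Any Q m → Any Q m')
           (fRel : Rel m → Rel m') where

    rel-extendˡ : ∀ l → Rel (l ++ m) → Rel (l ++ m')
    rel-extendˡ l z with rel-++⁻ l z
    ... | inj₁ zl                    = rel-++⁺ l (inj₁ zl)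
    ... | inj₂ (inj₁ zm)             = rel-++⁺ l (inj₂ (inj₁ (fRel zm)))
    ... | inj₂ (inj₂ (inj₁ (p , q))) = rel-++⁺ l (inj₂ (inj₂ (inj₁ (p , fQ q))))
    ... | inj₂ (inj₂ (inj₂ (q , p))) = rel-++⁺ l (inj₂ (inj₂ (inj₂ (q , fP p))))

    rel-extendʳ : ∀ r → Rel (m ++ r) → Rel (m' ++ r)
    rel-extendʳ r z with rel-++⁻ m z
    ... | inj₁ zm                    = rel-++⁺ m' (inj₁ (fRel zm))
    ... | inj₂ (inj₁ zr)             = rel-++⁺ m' (inj₂ (inj₁ zr))
    ... | inj₂ (inj₂ (inj₁ (p , q))) = rel-++⁺ m' (inj₂ (inj₂ (inj₁ (fP p , q))))
    ... | inj₂ (inj₂ (inj₂ (q , p))) = rel-++⁺ m' (inj₂ (inj₂ (inj₂ (fQ q , p))))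

  rel-context : ∀ l r {m m' : List A} → (Any P m → Any P m') → (Any Q m → Any Q m') →
                (Rel m → Rel m') → Rel (l ++ m ++ r) → Rel (l ++ m' ++ r)
  rel-context l r fP fQ fRel =
    rel-extendˡ (any-context [] r fP) (any-context [] r fQ) (rel-extendʳ fP fQ fRel r) l

Child : Set
Child = Bool × Tree

Below : ℕ → Child → Set
Below x (_ , c) = x ∈ leaves c

Below1 : ℕ → Child → Set
Below1 y (b , c) = y ∈ leaves c × (b ≡ true ⊎ Has1 c y)

XRIn : ℕ → ℕ → Child → Set
XRIn x y (_ , c) = XR c x y

-- Rel x y cs will be shown equivalent to XR (node cs) x y
module _ (x y : ℕ) where
  open Divergence (Below x) (Below1 y) (XRIn x y) public
    using (Rel; two-at; two-index; rel-context)

leavesL⇒any : ∀ {x} cs → x ∈ leavesL cs → Any (Below x) cs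
leavesL⇒any ((_ , c) ∷ cs) x∈ with ++⁻ (leaves c) x∈
... | inj₁ x∈c  = here x∈c
... | inj₂ x∈cs = there (leavesL⇒any cs x∈cs)

any⇒leavesL : ∀ {x} cs → Any (Below x) cs → x ∈ leavesL cs
any⇒leavesL ((_ , c) ∷ cs) (here x∈c)  = ++⁺ˡ x∈c
any⇒leavesL ((_ , c) ∷ cs) (there x∈) = ++⁺ʳ (leaves c) (any⇒leavesL cs x∈)

has1⇒any : ∀ {cs y} → Has1 (node cs) y → Any (Below1 y) cs
has1⇒any (step i y∈ h) = lose (∈-lookup i) (y∈ , h)

any⇒has1 : ∀ {cs y} → Any (Below1 y) cs → Has1 (node cs) y
any⇒has1 a = step (index a) (proj₁ (lookup-index a)) (proj₂ (lookup-index a))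

xr⇒rel : ∀ {cs x y} → XR (node cs) x y → Rel x y cs
xr⇒rel {cs} (top i j i≢j x∈ y∈ h) = inj₁ (two-at _ _ cs i j i≢j x∈ (y∈ , h))
xr⇒rel      (down i r)            = inj₂ (lose (∈-lookup i) r)

rel⇒xr : ∀ {cs x y} → Rel x y cs → XR (node cs) x y
rel⇒xr (inj₁ t) = top i j distinct P-at (proj₁ Q-at) (proj₂ Q-at)
  where open Divergence.TwoAt (two-index _ _ t)
rel⇒xr (inj₂ a) = down (index a) (lookup-index a)

has1⇒leaf : ∀ {c y} → Has1 c y → y ∈ leaves c
has1⇒leaf {node cs} h = any⇒leavesL cs (Any.map proj₁ (has1⇒any h))

record _⊑_ (c c' : Tree) : Set where
  field
    leaf⊆ : ∀ {x} → x ∈ leaves c → x ∈ leaves c'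
    has1⊆ : ∀ {y} → Has1 c y → Has1 c' y
    xr⊆   : ∀ {x y} → XR c x y → XR c' x y
open _⊑_

⊑-context : ∀ l r {m m'} → node m ⊑ node m' → node (l ++ m ++ r) ⊑ node (l ++ m' ++ r)
⊑-context l r {m} {m'} m⊑m' = record
  { leaf⊆ = λ x∈ → any⇒leavesL (l ++ m' ++ r) (any-context l r below (leavesL⇒any (l ++ m ++ r) x∈))
  ; has1⊆ = λ h → any⇒has1 (any-context l r below1 (has1⇒any h))
  ; xr⊆   = λ z → rel⇒xr (rel-context _ _ l r below below1 rel (xr⇒rel z))
  }
  where
  rel : ∀ {x y} → Rel x y m → Rel x y m'
  rel w = xr⇒rel (xr⊆ m⊑m' (rel⇒xr w))
  below : ∀ {x} → Any (Below x) m → Any (Below x) m'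
  below a = leavesL⇒any m' (leaf⊆ m⊑m' (any⇒leavesL m a))
  below1 : ∀ {y} → Any (Below1 y) m → Any (Below1 y) m'
  below1 a = has1⇒any (has1⊆ m⊑m' (any⇒has1 a))

⊑-child : ∀ {c c'} b → c ⊑ c' → node ((b , c) ∷ []) ⊑ node ((b , c') ∷ [])
⊑-child b c⊑c' = record
  { leaf⊆ = λ x∈ → ++⁺ˡ (leaf⊆ c⊑c' (∈-++[] _ x∈))
  ; has1⊆ = λ { (step zero y∈ h) → step zero (leaf⊆ c⊑c' y∈) (Sum.map₂ (has1⊆ c⊑c') h) }
  ; xr⊆   = λ { (top zero zero 0≢0 _ _ _) → ⊥-elim (0≢0 refl)
              ; (down zero z) → down zero (xr⊆ c⊑c' z) }
  }

⊑-expand : ∀ b ds → node ds ⊑ node ((b , node ds) ∷ [])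
⊑-expand b ds = record
  { leaf⊆ = ++⁺ˡ
  ; has1⊆ = λ h → step zero (has1⇒leaf h) (inj₂ h)
  ; xr⊆   = down zero
  }

⊑-contract0 : ∀ ds → node ((false , node ds) ∷ []) ⊑ node ds
⊑-contract0 ds = record
  { leaf⊆ = ∈-++[] (leavesL ds)
  ; has1⊆ = λ { (step zero _ (inj₂ h)) → h }
  ; xr⊆   = λ { (top zero zero 0≢0 _ _ _) → ⊥-elim (0≢0 refl)
              ; (down zero z) → z }
  }

contracted⊑ : ∀ {t b tₑ} → Contract t b tₑ → tₑ ⊑ t
contracted⊑ (here l r b ds)   = ⊑-context l r (⊑-expand b ds)
contracted⊑ (there l r b₀ C) = ⊑-context l r (⊑-child b₀ (contracted⊑ C))

⊑contracted0 : ∀ {t tₑ} → Contract t false tₑ → t ⊑ tₑ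
⊑contracted0 (here l r .false ds) = ⊑-context l r (⊑-contract0 ds)
⊑contracted0 (there l r b₀ C)     = ⊑-context l r (⊑-child b₀ (⊑contracted0 C))

𝒳-mono : ∀ {c c'} → c ⊑ c' → ∀ {x y} → 𝒳 c x y → 𝒳 c' x y
𝒳-mono c⊑c' (x≢y , z) = x≢y , xr⊆ c⊑c' z

lemma5 : (t tₑ : Tree) (b : Bool) → Phylogenetic t → Contract t b tₑ →
         (b ≡ false → (x y : ℕ) → (𝒳 tₑ x y → 𝒳 t x y) × (𝒳 t x y → 𝒳 tₑ x y)) ×
         (b ≡ true → (x y : ℕ) → 𝒳 tₑ x y → 𝒳 t x y)
lemma5 t tₑ b _ C = zero-edge , (λ _ _ _ → 𝒳-mono (contracted⊑ C))
  where
  zero-edge : b ≡ false → (x y : ℕ) → (𝒳 tₑ x y → 𝒳 t x y) × (𝒳 t x y → 𝒳 tₑ x y)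
  zero-edge b≡false _ _ =
    𝒳-mono (contracted⊑ C) , 𝒳-mono (⊑contracted0 (subst (λ b → Contract t b tₑ) b≡false C))
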